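{- Let $m$ be odd and let $c$ be an integer with $1<c<m/2$ and $\gcd(c,m)=1$. Then $G_{\alpha}(m;1,1,c)$ is 3-edge-colorable.
   Context: Let $G$ be the graph with the 11 vertices $A,B,A',B',v,x_1,\dots,x_6$ and the 14 edges $Av,\ vA',\ Ax_6,\ x_6x_2,\ x_6x_5,\ x_2x_4,\ x_2B,\ x_4x_3,\ x_4B',\ x_3A',\ x_3x_5,\ x_5x_1,\ x_1B,\ x_1B'$. For integers $m\ge 3$, $a,b$ with $1\le a,b\le m-1$ and $1\le c<m/2$, $G_{\alpha}(m;a,b,c)$ is the cubic graph with vertex set $\{u_i: u\in V(G),\ i\in\mathbb{Z}_m\}\cup\{w_i: i\in\mathbb{Z}_m\}$ and edges $u_iu'_i$ for every edge $uu'$ of $G$, spoke edges $v_iw_i$, loop edges $w_iw_{i+c}$, and connecting edges $A'_iA_{i+a}$, $B'_iB_{i+b}$ (indices mod $m$). -}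

module Defs where

open import Data.Nat using (ℕ; suc; _+_; _%_; NonZero)
open import Data.Nat.DivMod using (m%n<n)
open import Data.Fin using (Fin; toℕ; fromℕ<)
open import Data.Product using (_×_; _,_; proj₁; proj₂; Σ)
open import Data.Sum using (_⊎_)
open import Relation.Binary.PropositionalEquality using (_≡_; _≢_)

-- Vertex "types": the 11 vertices of the base graph G, plus w.
data BaseV : Set where
  A B A' B' v x1 x2 x3 x4 x5 x6 w : BaseV

-- Edge "types": the 14 edges of G, spoke, loop, and the two connecting edges.
data EdgeKind : Set where
  eAv evA' eAx6 ex6x2 ex6x5 ex2x4 ex2B ex4x3 ex4B' ex3A' ex3x5 ex5x1 ex1B ex1B' : EdgeKind
  spoke loop connA connB : EdgeKind

Vertex : ℕ → Set
Vertex m = BaseV × Fin m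

Edge : ℕ → Set
Edge m = EdgeKind × Fin m

shift : (m : ℕ) .{{_ : NonZero m}} → Fin m → ℕ → Fin m
shift m i k = fromℕ< (m%n<n (toℕ i + k) m)

ends : (m a b c : ℕ) .{{_ : NonZero m}} → Edge m → Vertex m × Vertex m
ends m a b c (eAv   , i) = (A  , i) , (v  , i)
ends m a b c (evA'  , i) = (v  , i) , (A' , i)
ends m a b c (eAx6  , i) = (A  , i) , (x6 , i)
ends m a b c (ex6x2 , i) = (x6 , i) , (x2 , i)
ends m a b c (ex6x5 , i) = (x6 , i) , (x5 , i)
ends m a b c (ex2x4 , i) = (x2 , i) , (x4 , i)
ends m a b c (ex2B  , i) = (x2 , i) , (B  , i)
ends m a b c (ex4x3 , i) = (x4 , i) , (x3 , i)
ends m a b c (ex4B' , i) = (x4 , i) , (B' , i)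
ends m a b c (ex3A' , i) = (x3 , i) , (A' , i)
ends m a b c (ex3x5 , i) = (x3 , i) , (x5 , i)
ends m a b c (ex5x1 , i) = (x5 , i) , (x1 , i)
ends m a b c (ex1B  , i) = (x1 , i) , (B  , i)
ends m a b c (ex1B' , i) = (x1 , i) , (B' , i)
ends m a b c (spoke , i) = (v  , i) , (w  , i)
ends m a b c (loop  , i) = (w  , i) , (w  , shift m i c)
ends m a b c (connA , i) = (A' , i) , (A  , shift m i a)
ends m a b c (connB , i) = (B' , i) , (B  , shift m i b)

Incident : (m a b c : ℕ) .{{_ : NonZero m}} → Edge m → Vertex m → Set
Incident m a b c e u = proj₁ (ends m a b c e) ≡ u ⊎ proj₂ (ends m a b c e) ≡ u

IsProperEdgeColouring : (m a b c : ℕ) .{{_ : NonZero m}} → (k : ℕ) → (Edge m → Fin k) → Set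
IsProperEdgeColouring m a b c k col =
  ∀ (e e' : Edge m) (u : Vertex m) →
    e ≢ e' → Incident m a b c e u → Incident m a b c e' u → col e ≢ col e'

ThreeEdgeColourable : (m a b c : ℕ) .{{_ : NonZero m}} → Set
ThreeEdgeColourable m a b c = Σ (Edge m → Fin 3) (IsProperEdgeColouring m a b c 3)

-- Cut the graph into the m blocks indexed by i: the copy G_i, the spoke v_i w_i, the loop edge
-- w_i w_{i+c} and the connecting edges leaving A'_i and B'_i.  Let (a , b) be the colours of the
-- connecting edges entering A_i, B_i, s that of the spoke and (a′ , b′) those leaving A'_i, B'_i.
-- The block can be coloured properly whenever (a , b) goes to (a′ , b′) under s by one of four
-- transitions: keep the colour at A, keep the colour at B, merge into the spoke colour, or split
-- an equal pair.  So it suffices to colour the loop edges so that every w_i sees three colours,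
-- and to find a cyclic sequence of transitions driven by the resulting spoke colours.
--
-- Write m = q c + r; r ≠ 0 since gcd (c , m) = 1.  Cut 0 ≤ n < m at c − r, c, m − c and m − r
-- into five regions.  For n < m − c the loop edge at n gets the colour of the parity of ⌊n / c⌋,
-- so the loop edges at n and n + c differ; the loop edges at m − c ≤ n < m − r get the third
-- colour and the last r ones a colour fixed by the parity of q, which closes up the odd cycle
-- w_0 w_c w_{2c} ….  Within a region the transition states alternate with the parity of n, and
-- as m is odd the parities of the region boundaries only depend on those of c and q.  What
-- remains is a finite table of transitions indexed by these two parities.

module Submission where

open import Defs
open import Data.Bool using (Bool; true; false)
open import Data.Empty using (⊥-elim)
open import Data.Fin using (Fin; zero; suc; toℕ)
open import Data.Fin.Properties using (_≟_; all?; toℕ-fromℕ<; toℕ-injective; toℕ<n)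
open import Data.Nat using (ℕ; suc; _+_; _*_; _∸_; _≤_; _<_; _%_; _/_; _<?_; NonZero; z≤n; parity)
open import Data.Nat.Properties
  using (+-comm; +-assoc; +-identityʳ; +-cancelʳ-≡; +-cancelʳ-<; +-monoˡ-≤; +-monoˡ-<; m+[n∸m]≡n; m∸n+n≡m;
         m+n∸n≡m; m≤m+n; m≤n+m; m<n+m; m+n≤o⇒m≤o∸n; m<n⇒0<n∸m; ∸-monoʳ-<; ∸-monoˡ-<;
         ≤-refl; ≤-trans; <-trans; ≤-<-trans; <-≤-trans; <⇒≤; ≤⇒≯; ≮⇒≥; n≤1+n; m≤n⇒m<n∨m≡n;
         n≢0⇒n>0; <⇒≢; module ≤-Reasoning)
open import Data.Nat.DivMod
  using (m≡m%n+[m/n]*n; m%n≡m∸m/n*n; m%n<n; m%n≤n; m%n%n≡m%n; n%n≡0; [m+n]%n≡m%n; %-distribˡ-+;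
         %-remove-+ʳ; m<n⇒m%n≡m; /-congˡ; +-distrib-/-∣ʳ; m<n⇒m/n≡0; m*n/n≡m; m/n*n≤m; m/n≡1+[m∸n]/n)
open import Data.Nat.Divisibility using (_∣_; divides; ∣-refl; n∣m*n; m%n≡0⇒n∣m)
open import Data.Nat.GCD using (gcd)
open import Data.Nat.Coprimality using (gcd≡1⇒coprime)
open import Data.Parity as ℙ using (Parity; 0ℙ; 1ℙ; _⁻¹)
open import Data.Parity.Properties as ℙₚ using (suc-homo-⁻¹; +-homo-+; *-homo-*; ⁻¹-selfInverse; p+p≡0ℙ)
  renaming (_≟_ to _≟ℙ_)
open import Data.Product using (Σ; ∃; _×_; _,_; proj₁; proj₂)
open import Data.Sum using (_⊎_; inj₁; inj₂; [_,_]′)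
open import Data.Unit using (⊤; tt)
open import Function using (_∘_)
open import Relation.Binary.PropositionalEquality
  using (_≡_; _≢_; refl; sym; trans; cong; cong₂; subst; subst₂; module ≡-Reasoning)
open import Relation.Nullary using (Dec; yes; no; does; ¬?)
open import Relation.Nullary.Decidable
  using (_×-dec_; _⊎-dec_; _→-dec_; map′; from-yes; dec-true; dec-false)

-- Rainbow vertices

Triple : Set → Set
Triple X = X × X × X

map₃ : {X Y : Set} → (X → Y) → Triple X → Triple Y
map₃ f (x , y , z) = f x , f y , f z

data _∈₃_ {X : Set} (e : X) : Triple X → Set where
  first  : ∀ {y z} → e ∈₃ (e , y , z)
  second : ∀ {x z} → e ∈₃ (x , e , z)
  third  : ∀ {x y} → e ∈₃ (x , y , e)

third-≡ : {X : Set} {e x y z : X} → e ≡ z → e ∈₃ (x , y , z)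
third-≡ refl = third

Colour : Set
Colour = Fin 3

pattern red   = zero
pattern green = suc zero
pattern blue  = suc (suc zero)

Rainbow : Triple Colour → Set
Rainbow (x , y , z) = x ≢ y × x ≢ z × y ≢ z

rainbow? : ∀ t → Dec (Rainbow t)
rainbow? (x , y , z) = ¬? (x ≟ y) ×-dec ¬? (x ≟ z) ×-dec ¬? (y ≟ z)

rainbow-∈₃ : {X : Set} (f : X → Colour) {t : Triple X} {e e′ : X} →
  Rainbow (map₃ f t) → e ∈₃ t → e′ ∈₃ t → e ≢ e′ → f e ≢ f e′
rainbow-∈₃ f _              first  first  e≢e′ = ⊥-elim (e≢e′ refl)
rainbow-∈₃ f _              second second e≢e′ = ⊥-elim (e≢e′ refl)
rainbow-∈₃ f _              third  third  e≢e′ = ⊥-elim (e≢e′ refl)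
rainbow-∈₃ f (xy , _ , _)   first  second _    = xy
rainbow-∈₃ f (_ , xz , _)   first  third  _    = xz
rainbow-∈₃ f (xy , _ , _)   second first  _    = xy ∘ sym
rainbow-∈₃ f (_ , _ , yz)   second third  _    = yz
rainbow-∈₃ f (_ , xz , _)   third  first  _    = xz ∘ sym
rainbow-∈₃ f (_ , _ , yz)   third  second _    = yz ∘ sym

rainbow⇒proper : ∀ {m a b c} .{{_ : NonZero m}}
  (colour : Edge m → Colour) (edgesAt : Vertex m → Triple (Edge m)) →
  (∀ e u → Incident m a b c e u → e ∈₃ edgesAt u) →
  (∀ u → Rainbow (map₃ colour (edgesAt u))) →
  IsProperEdgeColouring m a b c 3 colour
rainbow⇒proper colour edgesAt incident rainbow e e′ u e≢e′ e∼u e′∼u =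
  rainbow-∈₃ colour (rainbow u) (incident e u e∼u) (incident e′ u e′∼u) e≢e′

-- Transitions through a block

data Shape : Set where
  keep-A keep-B merge split : Shape

Admissible : Shape → (a b s a′ b′ : Colour) → Set
Admissible keep-A a b s a′ b′ = s ≡ a × a′ ≡ a × Rainbow (a , b , b′)
Admissible keep-B a b s a′ b′ = s ≡ b × b′ ≡ b × Rainbow (a , b , a′)
Admissible merge  a b s a′ b′ = a′ ≡ s × b′ ≡ s × Rainbow (a , b , s)
Admissible split  a b s a′ b′ = b ≡ a × s ≡ a × Rainbow (a , a′ , b′)

admissible? : ∀ sh a b s a′ b′ → Dec (Admissible sh a b s a′ b′)
admissible? keep-A a b s a′ b′ = s ≟ a ×-dec a′ ≟ a ×-dec rainbow? (a , b , b′)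
admissible? keep-B a b s a′ b′ = s ≟ b ×-dec b′ ≟ b ×-dec rainbow? (a , b , a′)
admissible? merge  a b s a′ b′ = a′ ≟ s ×-dec b′ ≟ s ×-dec rainbow? (a , b , s)
admissible? split  a b s a′ b′ = b ≟ a ×-dec s ≟ a ×-dec rainbow? (a , a′ , b′)

Step : Colour × Colour → Colour → Colour × Colour → Set
Step (a , b) s (a′ , b′) = Σ Shape λ sh → Admissible sh a b s a′ b′

∃-Shape? : {P : Shape → Set} → (∀ sh → Dec (P sh)) → Dec (Σ Shape P)
∃-Shape? {P} P? = map′ from to (P? keep-A ⊎-dec P? keep-B ⊎-dec P? merge ⊎-dec P? split)
  where
  from : P keep-A ⊎ P keep-B ⊎ P merge ⊎ P split → Σ Shape P
  from (inj₁ p)               = keep-A , p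
  from (inj₂ (inj₁ p))        = keep-B , p
  from (inj₂ (inj₂ (inj₁ p))) = merge , p
  from (inj₂ (inj₂ (inj₂ p))) = split , p
  to : Σ Shape P → P keep-A ⊎ P keep-B ⊎ P merge ⊎ P split
  to (keep-A , p) = inj₁ p
  to (keep-B , p) = inj₂ (inj₁ p)
  to (merge , p)  = inj₂ (inj₂ (inj₁ p))
  to (split , p)  = inj₂ (inj₂ (inj₂ p))

step? : ∀ x s y → Dec (Step x s y)
step? (a , b) s (a′ , b′) = ∃-Shape? λ sh → admissible? sh a b s a′ b′

-- Block i consists of the edges (k , i).  Its terminals are coloured a, b (the connecting edges
-- entering A_i, B_i), s (the spoke), a′, b′ (the connecting edges leaving A'_i, B'_i), lo and li
-- (the loop edges leaving and entering w_i); the tables colour the fourteen edges of G_i.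
module Block (a b s a′ b′ lo : Colour) where

  colour : Shape → EdgeKind → Colour
  colour _ spoke = s
  colour _ loop  = lo
  colour _ connA = a′
  colour _ connB = b′
  colour keep-A eAv   = b
  colour keep-A evA'  = b′
  colour keep-A eAx6  = b′
  colour keep-A ex6x2 = a
  colour keep-A ex6x5 = b
  colour keep-A ex2x4 = b
  colour keep-A ex2B  = b′
  colour keep-A ex4x3 = b′
  colour keep-A ex4B' = a
  colour keep-A ex3A' = b
  colour keep-A ex3x5 = a
  colour keep-A ex5x1 = b′
  colour keep-A ex1B  = a
  colour keep-A ex1B' = b
  colour keep-B eAv   = a′
  colour keep-B evA'  = a
  colour keep-B eAx6  = b
  colour keep-B ex6x2 = a
  colour keep-B ex6x5 = a′
  colour keep-B ex2x4 = b
  colour keep-B ex2B  = a′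
  colour keep-B ex4x3 = a′
  colour keep-B ex4B' = a
  colour keep-B ex3A' = b
  colour keep-B ex3x5 = a
  colour keep-B ex5x1 = b
  colour keep-B ex1B  = a
  colour keep-B ex1B' = a′
  colour merge  eAv   = b
  colour merge  evA'  = a
  colour merge  eAx6  = s
  colour merge  ex6x2 = a
  colour merge  ex6x5 = b
  colour merge  ex2x4 = b
  colour merge  ex2B  = s
  colour merge  ex4x3 = s
  colour merge  ex4B' = a
  colour merge  ex3A' = b
  colour merge  ex3x5 = a
  colour merge  ex5x1 = s
  colour merge  ex1B  = a
  colour merge  ex1B' = b
  colour split  eAv   = a′
  colour split  evA'  = b′
  colour split  eAx6  = b′
  colour split  ex6x2 = a
  colour split  ex6x5 = a′
  colour split  ex2x4 = b′
  colour split  ex2B  = a′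
  colour split  ex4x3 = a′
  colour split  ex4B' = a
  colour split  ex3A' = a
  colour split  ex3x5 = b′
  colour split  ex5x1 = a
  colour split  ex1B  = b′
  colour split  ex1B' = a′

  around : Colour → Shape → BaseV → Triple Colour
  around li sh A  = colour sh eAv   , colour sh eAx6  , a
  around li sh B  = colour sh ex2B  , colour sh ex1B  , b
  around li sh A' = colour sh evA'  , colour sh ex3A' , a′
  around li sh B' = colour sh ex4B' , colour sh ex1B' , b′
  around li sh v  = colour sh eAv   , colour sh evA'  , s
  around li sh x1 = colour sh ex5x1 , colour sh ex1B  , colour sh ex1B'
  around li sh x2 = colour sh ex6x2 , colour sh ex2x4 , colour sh ex2B
  around li sh x3 = colour sh ex4x3 , colour sh ex3A' , colour sh ex3x5
  around li sh x4 = colour sh ex2x4 , colour sh ex4x3 , colour sh ex4B'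
  around li sh x5 = colour sh ex6x5 , colour sh ex3x5 , colour sh ex5x1
  around li sh x6 = colour sh eAx6  , colour sh ex6x2 , colour sh ex6x5
  around li sh w  = s , lo , li

∀-BaseV? : {P : BaseV → Set} → (∀ t → Dec (P t)) → Dec (∀ t → P t)
∀-BaseV? P? = map′
  (λ (pA , pB , pA' , pB' , pv , p1 , p2 , p3 , p4 , p5 , p6 , pw) → λ where
     A → pA ; B → pB ; A' → pA' ; B' → pB' ; v → pv ; x1 → p1 ; x2 → p2
     x3 → p3 ; x4 → p4 ; x5 → p5 ; x6 → p6 ; w → pw)
  (λ f → f A , f B , f A' , f B' , f v , f x1 , f x2 , f x3 , f x4 , f x5 , f x6 , f w)
  (P? A ×-dec P? B ×-dec P? A' ×-dec P? B' ×-dec P? v ×-dec P? x1 ×-dec P? x2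
    ×-dec P? x3 ×-dec P? x4 ×-dec P? x5 ×-dec P? x6 ×-dec P? w)

around-rainbow : ∀ sh {a b s a′ b′ lo li} → Admissible sh a b s a′ b′ → Rainbow (s , lo , li) →
  ∀ t → Rainbow (Block.around a b s a′ b′ lo li sh t)
around-rainbow keep-A (refl , refl , r) = from-yes
  (all? λ a → all? λ b → all? λ b′ → all? λ lo → all? λ li →
    rainbow? (a , b , b′) →-dec rainbow? (a , lo , li) →-dec
    ∀-BaseV? λ t → rainbow? (Block.around a b a a b′ lo li keep-A t)) _ _ _ _ _ r
around-rainbow keep-B (refl , refl , r) = from-yes
  (all? λ a → all? λ b → all? λ a′ → all? λ lo → all? λ li →
    rainbow? (a , b , a′) →-dec rainbow? (b , lo , li) →-dec
    ∀-BaseV? λ t → rainbow? (Block.around a b b a′ b lo li keep-B t)) _ _ _ _ _ r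
around-rainbow merge (refl , refl , r) = from-yes
  (all? λ a → all? λ b → all? λ s → all? λ lo → all? λ li →
    rainbow? (a , b , s) →-dec rainbow? (s , lo , li) →-dec
    ∀-BaseV? λ t → rainbow? (Block.around a b s s s lo li merge t)) _ _ _ _ _ r
around-rainbow split (refl , refl , r) = from-yes
  (all? λ a → all? λ a′ → all? λ b′ → all? λ lo → all? λ li →
    rainbow? (a , a′ , b′) →-dec rainbow? (a , lo , li) →-dec
    ∀-BaseV? λ t → rainbow? (Block.around a a a a′ b′ lo li split t)) _ _ _ _ _ r

-- Block schedules

unshift : (m : ℕ) .{{_ : NonZero m}} → Fin m → ℕ → Fin m
unshift m i k = shift m i (m ∸ k % m)

module _ (m : ℕ) .{{_ : NonZero m}} where
  open ≡-Reasoning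

  toℕ-shift : ∀ i k → toℕ (shift m i k) ≡ (toℕ i + k) % m
  toℕ-shift i k = toℕ-fromℕ< _

  [x%m+y]%m≡[x+y]%m : ∀ x y → (x % m + y) % m ≡ (x + y) % m
  [x%m+y]%m≡[x+y]%m x y = begin
    (x % m + y) % m         ≡⟨ %-distribˡ-+ (x % m) y m ⟩
    (x % m % m + y % m) % m ≡⟨ cong (λ z → (z + y % m) % m) (m%n%n≡m%n x m) ⟩
    (x % m + y % m) % m     ≡⟨ %-distribˡ-+ x y m ⟨
    (x + y) % m             ∎

  shift-shift : ∀ i {x y} → m ∣ x + y → shift m (shift m i x) y ≡ i
  shift-shift i {x} {y} m∣x+y = toℕ-injective (begin
    toℕ (shift m (shift m i x) y) ≡⟨ toℕ-shift (shift m i x) y ⟩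
    (toℕ (shift m i x) + y) % m   ≡⟨ cong (λ z → (z + y) % m) (toℕ-shift i x) ⟩
    ((toℕ i + x) % m + y) % m     ≡⟨ [x%m+y]%m≡[x+y]%m (toℕ i + x) y ⟩
    (toℕ i + x + y) % m           ≡⟨ cong (_% m) (+-assoc (toℕ i) x y) ⟩
    (toℕ i + (x + y)) % m         ≡⟨ %-remove-+ʳ (toℕ i) m∣x+y ⟩
    toℕ i % m                     ≡⟨ m<n⇒m%n≡m (toℕ<n i) ⟩
    toℕ i                         ∎)

  m∣k+[m∸k%m] : ∀ k → m ∣ k + (m ∸ k % m)
  m∣k+[m∸k%m] k = divides (suc (k / m)) (begin
    k + (m ∸ k % m)                 ≡⟨ cong (_+ (m ∸ k % m)) (m≡m%n+[m/n]*n k m) ⟩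
    k % m + k / m * m + (m ∸ k % m) ≡⟨ cong (_+ (m ∸ k % m)) (+-comm (k % m) (k / m * m)) ⟩
    k / m * m + k % m + (m ∸ k % m) ≡⟨ +-assoc (k / m * m) (k % m) (m ∸ k % m) ⟩
    k / m * m + (k % m + (m ∸ k % m)) ≡⟨ cong (k / m * m +_) (m+[n∸m]≡n (m%n≤n k m)) ⟩
    k / m * m + m                   ≡⟨ +-comm (k / m * m) m ⟩
    suc (k / m) * m                 ∎)

  shift-unshift : ∀ i k → shift m (unshift m i k) k ≡ i
  shift-unshift i k = shift-shift i (subst (m ∣_) (+-comm k (m ∸ k % m)) (m∣k+[m∸k%m] k))

  unshift-shift : ∀ i k → unshift m (shift m i k) k ≡ i
  unshift-shift i k = shift-shift i (m∣k+[m∸k%m] k)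

record BlockSchedule (m a b c : ℕ) .{{_ : NonZero m}} : Set where
  field
    inA inB spokeColour loopColour : Fin m → Colour
    transfer : ∀ i → Step (inA i , inB i) (spokeColour i) (inA (shift m i a) , inB (shift m i b))
    rainbow-at-w : ∀ i → Rainbow (spokeColour i , loopColour i , loopColour (unshift m i c))

module _ {m a b c : ℕ} .{{_ : NonZero m}} (S : BlockSchedule m a b c) where
  open BlockSchedule S

  private
    block : Fin m → Colour → Shape → BaseV → Triple Colour
    block i = Block.around (inA i) (inB i) (spokeColour i) (inA (shift m i a)) (inB (shift m i b)) (loopColour i)

    colouring : Edge m → Colour
    colouring (k , i) = Block.colour (inA i) (inB i) (spokeColour i)
      (inA (shift m i a)) (inB (shift m i b)) (loopColour i) (proj₁ (transfer i)) k

    edgesAt : Vertex m → Triple (Edge m)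
    edgesAt (A  , j) = (eAv , j)   , (eAx6 , j)  , (connA , unshift m j a)
    edgesAt (B  , j) = (ex2B , j)  , (ex1B , j)  , (connB , unshift m j b)
    edgesAt (A' , j) = (evA' , j)  , (ex3A' , j) , (connA , j)
    edgesAt (B' , j) = (ex4B' , j) , (ex1B' , j) , (connB , j)
    edgesAt (v  , j) = (eAv , j)   , (evA' , j)  , (spoke , j)
    edgesAt (x1 , j) = (ex5x1 , j) , (ex1B , j)  , (ex1B' , j)
    edgesAt (x2 , j) = (ex6x2 , j) , (ex2x4 , j) , (ex2B , j)
    edgesAt (x3 , j) = (ex4x3 , j) , (ex3A' , j) , (ex3x5 , j)
    edgesAt (x4 , j) = (ex2x4 , j) , (ex4x3 , j) , (ex4B' , j)
    edgesAt (x5 , j) = (ex6x5 , j) , (ex3x5 , j) , (ex5x1 , j)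
    edgesAt (x6 , j) = (eAx6 , j)  , (ex6x2 , j) , (ex6x5 , j)
    edgesAt (w  , j) = (spoke , j) , (loop , j)  , (loop , unshift m j c)

    ends-around : ∀ k i → let (u , u′) = ends m a b c (k , i) in
      (k , i) ∈₃ edgesAt u × (k , i) ∈₃ edgesAt u′
    ends-around eAv   i = first  , first
    ends-around evA'  i = second , first
    ends-around eAx6  i = second , first
    ends-around ex6x2 i = second , first
    ends-around ex6x5 i = third  , first
    ends-around ex2x4 i = second , first
    ends-around ex2B  i = third  , first
    ends-around ex4x3 i = second , first
    ends-around ex4B' i = third  , first
    ends-around ex3A' i = second , second
    ends-around ex3x5 i = third  , second
    ends-around ex5x1 i = third  , first
    ends-around ex1B  i = second , second
    ends-around ex1B' i = third  , second
    ends-around spoke i = third  , first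
    ends-around loop  i = second , third-≡ (cong (loop ,_) (sym (unshift-shift m i c)))
    ends-around connA i = third  , third-≡ (cong (connA ,_) (sym (unshift-shift m i a)))
    ends-around connB i = third  , third-≡ (cong (connB ,_) (sym (unshift-shift m i b)))

    incident⇒around : ∀ e u → Incident m a b c e u → e ∈₃ edgesAt u
    incident⇒around (k , i) _ (inj₁ refl) = proj₁ (ends-around k i)
    incident⇒around (k , i) _ (inj₂ refl) = proj₂ (ends-around k i)

    rainbow-in-block : ∀ j t → Rainbow (block j (loopColour (unshift m j c)) (proj₁ (transfer j)) t)
    rainbow-in-block j = around-rainbow (proj₁ (transfer j)) (proj₂ (transfer j)) (rainbow-at-w j)

    rainbow-around : ∀ u → Rainbow (map₃ colouring (edgesAt u))
    rainbow-around (A , j) = subst (λ i → Rainbow (colouring (eAv , j) , colouring (eAx6 , j) , inA i))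
      (sym (shift-unshift m j a)) (rainbow-in-block j A)
    rainbow-around (B , j) = subst (λ i → Rainbow (colouring (ex2B , j) , colouring (ex1B , j) , inB i))
      (sym (shift-unshift m j b)) (rainbow-in-block j B)
    rainbow-around (A' , j) = rainbow-in-block j A'
    rainbow-around (B' , j) = rainbow-in-block j B'
    rainbow-around (v  , j) = rainbow-in-block j v
    rainbow-around (x1 , j) = rainbow-in-block j x1
    rainbow-around (x2 , j) = rainbow-in-block j x2
    rainbow-around (x3 , j) = rainbow-in-block j x3
    rainbow-around (x4 , j) = rainbow-in-block j x4
    rainbow-around (x5 , j) = rainbow-in-block j x5
    rainbow-around (x6 , j) = rainbow-in-block j x6
    rainbow-around (w  , j) = rainbow-in-block j w

  schedule⇒colourable : ThreeEdgeColourable m a b c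
  schedule⇒colourable = colouring , rainbow⇒proper colouring edgesAt incident⇒around rainbow-around

-- Regions and tables

data Region : Set where
  R₀ R₁ R₂ R₃ R₄ : Region

next : Region → Region
next R₀ = R₁
next R₁ = R₂
next R₂ = R₃
next R₃ = R₄
next R₄ = R₀

byParity : {X : Set} → X → X → Parity → X
byParity x y 0ℙ = x
byParity x y 1ℙ = y

parityColour : Parity → Colour
parityColour = byParity red green

-- For n in region g, with pc and pq the parities of c and ⌊m / c⌋: the state entering block n,
-- given the parity p of n, and the colours of the spoke and of the loop edges leaving and
-- entering w_n, given the parity p of ⌊n / c⌋.
stateTable : (pc pq : Parity) → Region → Parity → Colour × Colour
stateTable 0ℙ 0ℙ R₀ = byParity (red , blue)   (green , green)
stateTable 0ℙ 0ℙ R₁ = byParity (red , blue)   (green , green)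
stateTable 0ℙ 0ℙ R₂ = byParity (blue , red)   (blue , green)
stateTable 0ℙ 0ℙ R₃ = byParity (red , green)  (blue , green)
stateTable 0ℙ 0ℙ R₄ = byParity (red , green)  (red , blue)
stateTable 0ℙ 1ℙ R₀ = byParity (green , blue) (green , red)
stateTable 0ℙ 1ℙ R₁ = byParity (blue , blue)  (green , red)
stateTable 0ℙ 1ℙ R₂ = byParity (blue , blue)  (red , green)
stateTable 0ℙ 1ℙ R₃ = byParity (red , blue)   (red , green)
stateTable 0ℙ 1ℙ R₄ = byParity (red , blue)   (green , blue)
stateTable 1ℙ 0ℙ R₀ = byParity (red , green)  (blue , green)
stateTable 1ℙ 0ℙ R₁ = byParity (red , green)  (blue , green)
stateTable 1ℙ 0ℙ R₂ = byParity (blue , red)   (blue , green)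
stateTable 1ℙ 0ℙ R₃ = byParity (blue , red)   (green , green)
stateTable 1ℙ 0ℙ R₄ = byParity (red , blue)   (red , green)
stateTable 1ℙ 1ℙ R₀ = byParity (red , green)  (blue , green)
stateTable 1ℙ 1ℙ R₁ = byParity (blue , red)   (blue , green)
stateTable 1ℙ 1ℙ R₂ = byParity (blue , red)   (blue , green)
stateTable 1ℙ 1ℙ R₃ = byParity (blue , red)   (green , red)
stateTable 1ℙ 1ℙ R₄ = byParity (blue , blue)  (green , red)

spokeTable : (pq : Parity) → Region → Colour
spokeTable 0ℙ R₀ = green
spokeTable 0ℙ R₁ = green
spokeTable 0ℙ R₂ = blue
spokeTable 0ℙ R₃ = green
spokeTable 0ℙ R₄ = red
spokeTable 1ℙ R₀ = green
spokeTable 1ℙ R₁ = blue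
spokeTable 1ℙ R₂ = blue
spokeTable 1ℙ R₃ = red
spokeTable 1ℙ R₄ = blue

loopTable : (pq : Parity) → Region → Parity → Colour
loopTable pq R₃ p = blue
loopTable pq R₄ p = byParity blue green pq
loopTable pq _  p = parityColour p

loopInTable : (pq : Parity) → Region → Parity → Colour
loopInTable pq R₀ p = loopTable pq R₃ p
loopInTable pq R₁ p = loopTable pq R₄ p
loopInTable pq _  p = parityColour (p ⁻¹)

entryParity : (pc pq : Parity) → Region → Parity
entryParity pc pq R₀ = 0ℙ
entryParity pc pq R₁ = pc ℙ.+ (1ℙ ℙ.+ (pq ℙ.* pc))
entryParity pc pq R₂ = pc
entryParity pc pq R₃ = 1ℙ ℙ.+ pc
entryParity pc pq R₄ = pq ℙ.* pc

endParity : (pc pq : Parity) → Region → Parity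
endParity pc pq R₄ = 1ℙ
endParity pc pq g  = entryParity pc pq (next g)

QuotientParity : (pq : Parity) → Region → Parity → Set
QuotientParity pq R₀ p = p ≡ 0ℙ
QuotientParity pq R₁ p = p ≡ 0ℙ
QuotientParity pq R₂ p = ⊤
QuotientParity pq R₃ p = p ≡ pq ⁻¹
QuotientParity pq R₄ p = p ≡ pq

quotientParity? : ∀ pq g p → Dec (QuotientParity pq g p)
quotientParity? pq R₀ p = p ≟ℙ 0ℙ
quotientParity? pq R₁ p = p ≟ℙ 0ℙ
quotientParity? pq R₂ p = yes tt
quotientParity? pq R₃ p = p ≟ℙ pq ⁻¹
quotientParity? pq R₄ p = p ≟ℙ pq

∀-Parity? : {P : Parity → Set} → (∀ p → Dec (P p)) → Dec (∀ p → P p)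
∀-Parity? P? = map′ (λ (p₀ , p₁) → λ { 0ℙ → p₀ ; 1ℙ → p₁ }) (λ f → f 0ℙ , f 1ℙ) (P? 0ℙ ×-dec P? 1ℙ)

∀-Region? : {P : Region → Set} → (∀ g → Dec (P g)) → Dec (∀ g → P g)
∀-Region? P? = map′
  (λ (p₀ , p₁ , p₂ , p₃ , p₄) → λ { R₀ → p₀ ; R₁ → p₁ ; R₂ → p₂ ; R₃ → p₃ ; R₄ → p₄ })
  (λ f → f R₀ , f R₁ , f R₂ , f R₃ , f R₄)
  (P? R₀ ×-dec P? R₁ ×-dec P? R₂ ×-dec P? R₃ ×-dec P? R₄)

table-within : ∀ pc pq g p → Step (stateTable pc pq g p) (spokeTable pq g) (stateTable pc pq g (p ⁻¹))
table-within = from-yes (∀-Parity? λ pc → ∀-Parity? λ pq → ∀-Region? λ g → ∀-Parity? λ p →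
  step? (stateTable pc pq g p) (spokeTable pq g) (stateTable pc pq g (p ⁻¹)))

table-across : ∀ pc pq g →
  Step (stateTable pc pq g (endParity pc pq g ⁻¹)) (spokeTable pq g) (stateTable pc pq (next g) (entryParity pc pq (next g)))
table-across = from-yes (∀-Parity? λ pc → ∀-Parity? λ pq → ∀-Region? λ g →
  step? (stateTable pc pq g (endParity pc pq g ⁻¹)) (spokeTable pq g) (stateTable pc pq (next g) (entryParity pc pq (next g))))

table-loop : ∀ pq g p → QuotientParity pq g p → Rainbow (spokeTable pq g , loopTable pq g p , loopInTable pq g p)
table-loop = from-yes (∀-Parity? λ pq → ∀-Region? λ g → ∀-Parity? λ p →
  quotientParity? pq g p →-dec rainbow? (spokeTable pq g , loopTable pq g p , loopInTable pq g p))

-- The schedule for G_α(m;1,1,c)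

parity-suc : ∀ n → parity (suc n) ≡ parity n ⁻¹
parity-suc n = sym (⁻¹-selfInverse (suc-homo-⁻¹ n))

parity-∸ : ∀ {m n} → n ≤ m → parity (m ∸ n) ≡ parity m ℙ.+ parity n
parity-∸ {m} {n} n≤m = begin
  parity (m ∸ n)                              ≡⟨ ℙₚ.+-identityʳ _ ⟨
  parity (m ∸ n) ℙ.+ 0ℙ                       ≡⟨ cong (parity (m ∸ n) ℙ.+_) (p+p≡0ℙ (parity n)) ⟨
  parity (m ∸ n) ℙ.+ (parity n ℙ.+ parity n)  ≡⟨ ℙₚ.+-assoc (parity (m ∸ n)) (parity n) (parity n) ⟨
  parity (m ∸ n) ℙ.+ parity n ℙ.+ parity n    ≡⟨ cong (ℙ._+ parity n) (+-homo-+ (m ∸ n) n) ⟨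
  parity (m ∸ n + n) ℙ.+ parity n             ≡⟨ cong (λ k → parity k ℙ.+ parity n) (m∸n+n≡m n≤m) ⟩
  parity m ℙ.+ parity n                       ∎
  where open ≡-Reasoning

quotient-unique : ∀ {c} .{{_ : NonZero c}} {j n} → j * c ≤ n → n < j * c + c → n / c ≡ j
quotient-unique {c} {j} {n} lo hi = begin
  n / c                   ≡⟨ /-congˡ (m∸n+n≡m lo) ⟨
  (n ∸ j * c + j * c) / c ≡⟨ +-distrib-/-∣ʳ (n ∸ j * c) (n∣m*n j) ⟩
  (n ∸ j * c) / c + j * c / c ≡⟨ cong₂ _+_ (m<n⇒m/n≡0 rest<c) (m*n/n≡m j c) ⟩
  j                       ∎
  where
  open ≡-Reasoning
  rest<c : n ∸ j * c < c
  rest<c = +-cancelʳ-< (j * c) (n ∸ j * c) c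
    (subst₂ _<_ (sym (m∸n+n≡m lo)) (+-comm (j * c) c) hi)

module Schedule (m c : ℕ) .{{_ : NonZero m}} .{{_ : NonZero c}}
                (m-odd : parity m ≡ 1ℙ) (c+c<m : c + c < m) (0<r : 0 < m % c) where

  r q b₁ b₃ b₄ : ℕ
  r  = m % c
  q  = m / c
  b₁ = c ∸ r
  b₃ = m ∸ c
  b₄ = q * c

  pc pq : Parity
  pc = parity c
  pq = parity q

  r<c : r < c
  r<c = m%n<n m c

  c<m : c < m
  c<m = ≤-<-trans (m≤m+n c c) c+c<m

  m≡r+b₄ : m ≡ r + b₄
  m≡r+b₄ = m≡m%n+[m/n]*n m c

  b₁+r≡c : b₁ + r ≡ c
  b₁+r≡c = m∸n+n≡m (<⇒≤ r<c)

  b₃+c≡m : b₃ + c ≡ m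
  b₃+c≡m = m∸n+n≡m (<⇒≤ c<m)

  b₁+b₃≡b₄ : b₁ + b₃ ≡ b₄
  b₁+b₃≡b₄ = +-cancelʳ-≡ r (b₁ + b₃) b₄ (begin
    b₁ + b₃ + r   ≡⟨ +-assoc b₁ b₃ r ⟩
    b₁ + (b₃ + r) ≡⟨ cong (b₁ +_) (+-comm b₃ r) ⟩
    b₁ + (r + b₃) ≡⟨ +-assoc b₁ r b₃ ⟨
    b₁ + r + b₃   ≡⟨ cong (_+ b₃) b₁+r≡c ⟩
    c + b₃        ≡⟨ +-comm c b₃ ⟩
    b₃ + c        ≡⟨ b₃+c≡m ⟩
    m             ≡⟨ m≡r+b₄ ⟩
    r + b₄        ≡⟨ +-comm r b₄ ⟩
    b₄ + r        ∎)
    where open ≡-Reasoning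

  0<b₁ : 0 < b₁
  0<b₁ = m<n⇒0<n∸m r<c

  b₁<c : b₁ < c
  b₁<c = ∸-monoʳ-< 0<r (<⇒≤ r<c)

  c<b₃ : c < b₃
  c<b₃ = m+n≤o⇒m≤o∸n (suc c) c+c<m

  b₃<b₄ : b₃ < b₄
  b₃<b₄ = +-cancelʳ-< c b₃ b₄ (begin-strict
    b₃ + c ≡⟨ b₃+c≡m ⟩
    m      ≡⟨ m≡r+b₄ ⟩
    r + b₄ <⟨ +-monoˡ-< b₄ r<c ⟩
    c + b₄ ≡⟨ +-comm c b₄ ⟩
    b₄ + c ∎)
    where open ≤-Reasoning

  b₄<m : b₄ < m
  b₄<m = subst (b₄ <_) (sym m≡r+b₄) (m<n+m b₄ 0<r)

  start end : Region → ℕ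
  start R₀ = 0
  start R₁ = b₁
  start R₂ = c
  start R₃ = b₃
  start R₄ = b₄
  end R₄ = m
  end g  = start (next g)

  start<end : ∀ g → start g < end g
  start<end R₀ = 0<b₁
  start<end R₁ = b₁<c
  start<end R₂ = c<b₃
  start<end R₃ = b₃<b₄
  start<end R₄ = b₄<m

  end%m≡start-next : ∀ g → end g % m ≡ start (next g)
  end%m≡start-next R₀ = m<n⇒m%n≡m (<-trans b₁<c c<m)
  end%m≡start-next R₁ = m<n⇒m%n≡m c<m
  end%m≡start-next R₂ = m<n⇒m%n≡m (<-trans b₃<b₄ b₄<m)
  end%m≡start-next R₃ = m<n⇒m%n≡m b₄<m
  end%m≡start-next R₄ = n%n≡0 m

  end≤m : ∀ g → end g ≤ m
  end≤m R₀ = <⇒≤ (<-trans b₁<c c<m)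
  end≤m R₁ = <⇒≤ c<m
  end≤m R₂ = <⇒≤ (<-trans b₃<b₄ b₄<m)
  end≤m R₃ = <⇒≤ b₄<m
  end≤m R₄ = ≤-refl

  first-true : Bool → Bool → Bool → Bool → Region
  first-true true  _     _     _     = R₀
  first-true false true  _     _     = R₁
  first-true false false true  _     = R₂
  first-true false false false true  = R₃
  first-true false false false false = R₄

  region : ℕ → Region
  region n = first-true (does (n <? b₁)) (does (n <? c)) (does (n <? b₃)) (does (n <? b₄))

  first-true-≡ : ∀ {x₁ x₂ x₃ x₄ y₁ y₂ y₃ y₄} → x₁ ≡ y₁ → x₂ ≡ y₂ → x₃ ≡ y₃ → x₄ ≡ y₄ →
    first-true x₁ x₂ x₃ x₄ ≡ first-true y₁ y₂ y₃ y₄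
  first-true-≡ refl refl refl refl = refl

  region-unique : ∀ g {n} → start g ≤ n → n < end g → region n ≡ g
  region-unique R₀ {n} _ n<b₁ =
    first-true-≡ (dec-true (n <? b₁) n<b₁) refl refl refl
  region-unique R₁ {n} b₁≤n n<c =
    first-true-≡ (dec-false (n <? b₁) (≤⇒≯ b₁≤n)) (dec-true (n <? c) n<c) refl refl
  region-unique R₂ {n} c≤n n<b₃ =
    first-true-≡ (dec-false (n <? b₁) (≤⇒≯ (≤-trans (<⇒≤ b₁<c) c≤n))) (dec-false (n <? c) (≤⇒≯ c≤n))
                 (dec-true (n <? b₃) n<b₃) refl
  region-unique R₃ {n} b₃≤n n<b₄ =
    first-true-≡ (dec-false (n <? b₁) (≤⇒≯ (≤-trans (<⇒≤ (<-trans b₁<c c<b₃)) b₃≤n)))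
                 (dec-false (n <? c) (≤⇒≯ (≤-trans (<⇒≤ c<b₃) b₃≤n)))
                 (dec-false (n <? b₃) (≤⇒≯ b₃≤n)) (dec-true (n <? b₄) n<b₄)
  region-unique R₄ {n} b₄≤n _ =
    first-true-≡ (dec-false (n <? b₁) (≤⇒≯ (≤-trans (<⇒≤ (<-trans (<-trans b₁<c c<b₃) b₃<b₄)) b₄≤n)))
                 (dec-false (n <? c) (≤⇒≯ (≤-trans (<⇒≤ (<-trans c<b₃ b₃<b₄)) b₄≤n)))
                 (dec-false (n <? b₃) (≤⇒≯ (≤-trans (<⇒≤ b₃<b₄) b₄≤n))) (dec-false (n <? b₄) (≤⇒≯ b₄≤n))

  locate : ∀ n → n < m → Σ Region λ g → start g ≤ n × n < end g
  locate n n<m with n <? b₁ | n <? c | n <? b₃ | n <? b₄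
  ... | yes n<b₁ | _       | _       | _       = R₀ , z≤n , n<b₁
  ... | no  n≮b₁ | yes n<c | _       | _       = R₁ , ≮⇒≥ n≮b₁ , n<c
  ... | no  _    | no  n≮c | yes n<b₃ | _      = R₂ , ≮⇒≥ n≮c , n<b₃
  ... | no  _    | no  _   | no  n≮b₃ | yes n<b₄ = R₃ , ≮⇒≥ n≮b₃ , n<b₄
  ... | no  _    | no  _   | no  _    | no  n≮b₄ = R₄ , ≮⇒≥ n≮b₄ , n<m

  region-bounds : ∀ n → n < m → start (region n) ≤ n × n < end (region n)
  region-bounds n n<m with locate n n<m
  ... | g , lo , hi rewrite region-unique g lo hi = lo , hi

  parity-start : ∀ g → parity (start g) ≡ entryParity pc pq g
  parity-start R₀ = refl
  parity-start R₁ = begin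
    parity (c ∸ r)           ≡⟨ parity-∸ (<⇒≤ r<c) ⟩
    pc ℙ.+ parity r          ≡⟨ cong (pc ℙ.+_) (cong parity (m%n≡m∸m/n*n m c)) ⟩
    pc ℙ.+ parity (m ∸ b₄)   ≡⟨ cong (pc ℙ.+_) (parity-∸ (m/n*n≤m m c)) ⟩
    pc ℙ.+ (parity m ℙ.+ parity b₄) ≡⟨ cong₂ (λ x y → pc ℙ.+ (x ℙ.+ y)) m-odd (*-homo-* q c) ⟩
    pc ℙ.+ (1ℙ ℙ.+ (pq ℙ.* pc)) ∎
    where open ≡-Reasoning
  parity-start R₂ = refl
  parity-start R₃ = trans (parity-∸ (<⇒≤ c<m)) (cong (ℙ._+ pc) m-odd)
  parity-start R₄ = *-homo-* q c

  parity-end : ∀ g → parity (end g) ≡ endParity pc pq g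
  parity-end R₀ = parity-start R₁
  parity-end R₁ = parity-start R₂
  parity-end R₂ = parity-start R₃
  parity-end R₃ = parity-start R₄
  parity-end R₄ = m-odd

  stateAt : ℕ → Colour × Colour
  stateAt n = stateTable pc pq (region n) (parity n)

  spokeAt : ℕ → Colour
  spokeAt n = spokeTable pq (region n)

  step-by-table : ∀ {n n′ g g′ p p′} → region n ≡ g → parity n ≡ p → region n′ ≡ g′ → parity n′ ≡ p′ →
    Step (stateTable pc pq g p) (spokeTable pq g) (stateTable pc pq g′ p′) →
    Step (stateAt n) (spokeAt n) (stateAt n′)
  step-by-table refl refl refl refl st = st

  step-inside : ∀ {n} → start (region n) ≤ n → suc n < end (region n) →
    Step (stateAt n) (spokeAt n) (stateAt (suc n % m))
  step-inside {n} lo 1+n<end = subst (λ k → Step (stateAt n) (spokeAt n) (stateAt k))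
    (sym (m<n⇒m%n≡m (<-≤-trans 1+n<end (end≤m (region n)))))
    (step-by-table refl refl (region-unique (region n) (≤-trans lo (n≤1+n n)) 1+n<end) (parity-suc n)
      (table-within pc pq (region n) (parity n)))

  step-across : ∀ {n} → suc n ≡ end (region n) → Step (stateAt n) (spokeAt n) (stateAt (suc n % m))
  step-across {n} 1+n≡end = subst (λ k → Step (stateAt n) (spokeAt n) (stateAt k))
    (sym (trans (cong (_% m) 1+n≡end) (end%m≡start-next g)))
    (step-by-table refl parity-n (region-unique (next g) ≤-refl (start<end (next g))) (parity-start (next g))
      (table-across pc pq g))
    where
    g = region n
    parity-n : parity n ≡ endParity pc pq g ⁻¹
    parity-n = trans (sym (suc-homo-⁻¹ n)) (cong _⁻¹ (trans (cong parity 1+n≡end) (parity-end g)))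

  state-step : ∀ n → n < m → Step (stateAt n) (spokeAt n) (stateAt (suc n % m))
  state-step n n<m = let (lo , hi) = region-bounds n n<m in
    [ step-inside lo , step-across ]′ (m≤n⇒m<n∨m≡n hi)

  loopAt : ℕ → Colour
  loopAt n = loopTable pq (region n) (parity (n / c))

  1+[n/c]≡q : ∀ {n} → b₃ ≤ n → n < b₄ → suc (n / c) ≡ q
  1+[n/c]≡q {n} b₃≤n n<b₄ = begin
    suc (n / c)           ≡⟨ cong (λ k → suc (k / c)) (m+n∸n≡m n c) ⟨
    suc ((n + c ∸ c) / c) ≡⟨ m/n≡1+[m∸n]/n (m≤n+m c n) ⟨
    (n + c) / c           ≡⟨ quotient-unique b₄≤n+c (+-monoˡ-< c n<b₄) ⟩
    q                     ∎
    where
    open ≡-Reasoning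
    b₄≤n+c : b₄ ≤ n + c
    b₄≤n+c = ≤-trans (<⇒≤ b₄<m) (subst (_≤ n + c) b₃+c≡m (+-monoˡ-≤ c b₃≤n))

  n/c≡q : ∀ {n} → b₄ ≤ n → n < m → n / c ≡ q
  n/c≡q {n} b₄≤n n<m = quotient-unique b₄≤n (begin-strict
    n      <⟨ n<m ⟩
    m      ≡⟨ m≡r+b₄ ⟩
    r + b₄ <⟨ +-monoˡ-< b₄ r<c ⟩
    c + b₄ ≡⟨ +-comm c b₄ ⟩
    b₄ + c ∎)
    where open ≤-Reasoning

  quotient-parity : ∀ n → n < m → QuotientParity pq (region n) (parity (n / c))
  quotient-parity n n<m with region n | region-bounds n n<m
  ... | R₀ | _ , n<b₁      = cong parity (m<n⇒m/n≡0 (<-trans n<b₁ b₁<c))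
  ... | R₁ | _ , n<c       = cong parity (m<n⇒m/n≡0 n<c)
  ... | R₂ | _             = tt
  ... | R₃ | b₃≤n , n<b₄   = trans (sym (suc-homo-⁻¹ (n / c))) (cong (λ k → parity k ⁻¹) (1+[n/c]≡q b₃≤n n<b₄))
  ... | R₄ | b₄≤n , _      = cong parity (n/c≡q b₄≤n n<m)

  loop-below : ∀ {n} → n < b₃ → loopAt n ≡ parityColour (parity (n / c))
  loop-below {n} n<b₃ with region n | region-bounds n (<-trans n<b₃ (<-trans b₃<b₄ b₄<m))
  ... | R₀ | _ = refl
  ... | R₁ | _ = refl
  ... | R₂ | _ = refl
  ... | R₃ | b₃≤n , _ = ⊥-elim (≤⇒≯ b₃≤n n<b₃)
  ... | R₄ | b₄≤n , _ = ⊥-elim (≤⇒≯ (≤-trans (<⇒≤ b₃<b₄) b₄≤n) n<b₃)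

  loop-predecessor-above : ∀ {n} → c ≤ n → n < m → loopAt ((n + b₃) % m) ≡ parityColour (parity (n / c) ⁻¹)
  loop-predecessor-above {n} c≤n n<m = begin
    loopAt ((n + b₃) % m)      ≡⟨ cong loopAt n+b₃%m≡n∸c ⟩
    loopAt (n ∸ c)             ≡⟨ loop-below n∸c<b₃ ⟩
    parityColour (parity ((n ∸ c) / c)) ≡⟨ cong parityColour (sym (suc-homo-⁻¹ ((n ∸ c) / c))) ⟩
    parityColour (parity (suc ((n ∸ c) / c)) ⁻¹) ≡⟨ cong (λ k → parityColour (parity k ⁻¹)) (m/n≡1+[m∸n]/n c≤n) ⟨
    parityColour (parity (n / c) ⁻¹) ∎
    where
    open ≡-Reasoning
    n∸c<b₃ : n ∸ c < b₃
    n∸c<b₃ = ∸-monoˡ-< n<m c≤n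
    n+b₃%m≡n∸c : (n + b₃) % m ≡ n ∸ c
    n+b₃%m≡n∸c = begin
      (n + b₃) % m         ≡⟨ cong (λ k → (k + b₃) % m) (m∸n+n≡m c≤n) ⟨
      (n ∸ c + c + b₃) % m ≡⟨ cong (_% m) (+-assoc (n ∸ c) c b₃) ⟩
      (n ∸ c + (c + b₃)) % m ≡⟨ cong (λ k → (n ∸ c + k) % m) (trans (+-comm c b₃) b₃+c≡m) ⟩
      (n ∸ c + m) % m      ≡⟨ [m+n]%n≡m%n (n ∸ c) m ⟩
      (n ∸ c) % m          ≡⟨ m<n⇒m%n≡m (<-trans n∸c<b₃ (<-trans b₃<b₄ b₄<m)) ⟩
      n ∸ c                ∎

  loop-predecessor : ∀ n → n < m → loopAt ((n + b₃) % m) ≡ loopInTable pq (region n) (parity (n / c))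
  loop-predecessor n n<m with region n | region-bounds n n<m
  ... | R₀ | _ , n<b₁ = trans (cong loopAt (m<n⇒m%n≡m (<-trans n+b₃<b₄ b₄<m)))
                              (cong (λ g → loopTable pq g (parity ((n + b₃) / c))) (region-unique R₃ (m≤n+m b₃ n) n+b₃<b₄))
    where
    n+b₃<b₄ : n + b₃ < b₄
    n+b₃<b₄ = subst (n + b₃ <_) b₁+b₃≡b₄ (+-monoˡ-< b₃ n<b₁)
  ... | R₁ | b₁≤n , n<c = trans (cong loopAt (m<n⇒m%n≡m n+b₃<m))
                                (cong (λ g → loopTable pq g (parity ((n + b₃) / c))) (region-unique R₄ b₄≤n+b₃ n+b₃<m))
    where
    n+b₃<m : n + b₃ < m
    n+b₃<m = subst (n + b₃ <_) (trans (+-comm c b₃) b₃+c≡m) (+-monoˡ-< b₃ n<c)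
    b₄≤n+b₃ : b₄ ≤ n + b₃
    b₄≤n+b₃ = subst (_≤ n + b₃) b₁+b₃≡b₄ (+-monoˡ-≤ b₃ b₁≤n)
  ... | R₂ | c≤n , _ = loop-predecessor-above c≤n n<m
  ... | R₃ | b₃≤n , _ = loop-predecessor-above (≤-trans (<⇒≤ c<b₃) b₃≤n) n<m
  ... | R₄ | b₄≤n , _ = loop-predecessor-above (≤-trans (<⇒≤ (<-trans c<b₃ b₃<b₄)) b₄≤n) n<m

  w-rainbow : ∀ n → n < m → Rainbow (spokeAt n , loopAt n , loopAt ((n + b₃) % m))
  w-rainbow n n<m = subst (λ x → Rainbow (spokeAt n , loopAt n , x)) (sym (loop-predecessor n n<m))
    (table-loop pq (region n) (parity (n / c)) (quotient-parity n n<m))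

  toℕ-next : ∀ i → toℕ (shift m i 1) ≡ suc (toℕ i) % m
  toℕ-next i = trans (toℕ-shift m i 1) (cong (_% m) (+-comm (toℕ i) 1))

  toℕ-unshift : ∀ i → toℕ (unshift m i c) ≡ (toℕ i + b₃) % m
  toℕ-unshift i = trans (toℕ-shift m i (m ∸ c % m)) (cong (λ k → (toℕ i + (m ∸ k)) % m) (m<n⇒m%n≡m c<m))

  schedule : BlockSchedule m 1 1 c
  schedule = record
    { inA          = proj₁ ∘ stateAt ∘ toℕ
    ; inB          = proj₂ ∘ stateAt ∘ toℕ
    ; spokeColour  = spokeAt ∘ toℕ
    ; loopColour   = loopAt ∘ toℕ
    ; transfer     = λ i → subst (λ k → Step (stateAt (toℕ i)) (spokeAt (toℕ i)) (stateAt k))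
                       (sym (toℕ-next i)) (state-step (toℕ i) (toℕ<n i))
    ; rainbow-at-w = λ i → subst (λ k → Rainbow (spokeAt (toℕ i) , loopAt (toℕ i) , loopAt k))
                       (sym (toℕ-unshift i)) (w-rainbow (toℕ i) (toℕ<n i))
    }

parity[1+2k]≡1ℙ : ∀ k → parity (suc (2 * k)) ≡ 1ℙ
parity[1+2k]≡1ℙ k = trans (parity-suc (2 * k)) (cong _⁻¹ (*-homo-* 2 k))

coprime⇒0<% : ∀ {m c} .{{_ : NonZero c}} → 1 < c → gcd c m ≡ 1 → 0 < m % c
coprime⇒0<% {m} {c} 1<c gcd≡1 = n≢0⇒n>0 λ m%c≡0 →
  <⇒≢ 1<c (sym (gcd≡1⇒coprime gcd≡1 (∣-refl , m%n≡0⇒n∣m m c m%c≡0)))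

theorem7 : (m c : ℕ) .{{_ : NonZero m}} →
    ∃ (λ k → m ≡ suc (2 * k)) → 1 < c → 2 * c < m → gcd c m ≡ 1 →
    ThreeEdgeColourable m 1 1 c
theorem7 m c@(suc _) (k , refl) 1<c 2c<m gcd≡1 = schedule⇒colourable
  (Schedule.schedule m c (parity[1+2k]≡1ℙ k) (subst (_< m) (cong (c +_) (+-identityʳ c)) 2c<m)
    (coprime⇒0<% {m} 1<c gcd≡1))
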